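{- Let $n$ be an even positive integer, $p$ a prime, and $p^a$ the largest power of $p$ dividing $n$. Suppose there is a prime $q$ with $n/3<q<n/2$ and $n-2q<p^a$. Say $n$ satisfies Condition 1 with $p$ and $q$ if $\binom{n}{k}$ is divisible by $p$ or by $q$ for every integer $k$ with $1\le k\le n-1$. Then: (a) if $p=2$, $n$ satisfies Condition 1 with $2$ and $q$; (b) if $p\ne2$, $n$ satisfies Condition 1 with $p$ and $q$ if and only if $p$ divides $\binom{n}{n/2}$. -}

module Defs where

open import Data.Nat using (ℕ; _≤_; _*_; _+_)
open import Data.Nat.Divisibility using (_∣_)
open import Data.Nat.Combinatorics using (_C_)
open import Data.Sum using (_⊎_)

-- Condition 1: for every k with 1 ≤ k ≤ n - 1, p ∣ (n C k) or q ∣ (n C k).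
-- (1 ≤ k and k + 1 ≤ n, i.e. k ≤ n - 1 without truncated subtraction.)
Condition1 : ℕ → ℕ → ℕ → Set
Condition1 n p q = ∀ (k : ℕ) → 1 ≤ k → k + 1 ≤ n → (p ∣ n C k) ⊎ (q ∣ n C k)

-- Write P = p ^ a for the exact power of p dividing n.  Two valuation facts
-- drive the proof.
--  * If p ∤ (n C k) then P ∣ k, because k · (n C k) = n · ((n-1) C (k-1)).
--  * For a prime q and r ≤ q, the power q ^ r divides j ! exactly when
--    r · q ≤ j.
-- Now let 0 < k < n with n C k prime to both p and q, and put l = n - k.
-- Both k and l are positive multiples of P.  From n < 2q + P ≤ 2q + l we get
-- k < 2q, so q² ∤ k !; since q² ∣ n ! = (n C k) · k ! · l ! this forces
-- q ∣ l !, i.e. q ≤ l, and symmetrically q ≤ k.  If k ≠ l, the two distinct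
-- multiples of P differ by at least P, so n = k + l ≥ 2q + P, a contradiction.
-- Hence the only possible exception is k = m, which gives (a) (for p = 2,
-- 2 ^ a ∣ m contradicts maximality of a) and the "if" half of (b).  The
-- "only if" half holds because q ∤ (2m C m): q occurs exactly twice in
-- (2m) ! (as 2m < 3q) and at least twice in m ! · m ! (as q ≤ m).
module Submission where

open import Defs
open import Data.Nat using (ℕ; _≤_; _<_; _*_; _+_; _∸_; _^_; suc)
open import Data.Nat.Divisibility using (_∣_)
open import Data.Nat.Primality using (Prime)
open import Data.Nat.Combinatorics using (_C_)
open import Data.Product using (_×_)
open import Function.Bundles using (_⇔_)
open import Relation.Nullary using (¬_)
open import Relation.Binary.PropositionalEquality using (_≡_; _≢_)

open import Data.Nat.Base using (zero; _!; s≤s; z<s; NonZero; nonTrivial⇒n>1; >-nonZero)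
open import Data.Nat.Properties
open import Data.Nat.Divisibility
  using (divides; _∣?_; 1∣_; ∣-trans; ∣1⇒≡1; ∣⇒≤; m∣m*n; n∣m*n; *-pres-∣; *-monoʳ-∣; *-monoˡ-∣;
         *-cancelˡ-∣; ∣m+n∣m⇒∣n; m*n∣⇒m∣; m≤n⇒m!∣n!)
open import Data.Nat.Primality using (euclidsLemma; prime⇒nonZero; prime⇒nonTrivial)
open import Data.Nat.Combinatorics using (nCk≡nC[n∸k]; nCk≡n!/k![n-k]!; k![n∸k]!∣n!)
open import Data.Nat.DivMod using (m/n*n≡m)
open import Data.Nat.Tactic.RingSolver using (solve-∀)
open import Data.Sum using (inj₁; inj₂)
open import Data.Product using (_,_)
open import Data.Empty using (⊥; ⊥-elim)
open import Relation.Nullary using (yes; no)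
open import Relation.Binary.Definitions using (tri<; tri≈; tri>)
open import Relation.Binary.PropositionalEquality using (refl; sym; trans; cong; subst; module ≡-Reasoning)
open import Function.Bundles using (mk⇔)

binomial-factorial : ∀ {n k} → k ≤ n → (n C k) * (k ! * (n ∸ k) !) ≡ n !
binomial-factorial {n} {k} k≤n =
  trans (cong (_* (k ! * (n ∸ k) !)) (nCk≡n!/k![n-k]! k≤n))
        (m/n*n≡m {{k !* (n ∸ k) !≢0}} (k![n∸k]!∣n! k≤n))

binomial-absorption : ∀ {n k} → k ≤ n → suc k * (suc n C suc k) ≡ suc n * (n C k)
binomial-absorption {n} {k} k≤n = *-cancelʳ-≡ _ _ (k ! * (n ∸ k) !) {{k !* (n ∸ k) !≢0}} (begin
    suc k * (suc n C suc k) * (k ! * (n ∸ k) !)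
      ≡⟨ regroup (suc k) (suc n C suc k) (k !) ((n ∸ k) !) ⟩
    (suc n C suc k) * (suc k ! * (n ∸ k) !)
      ≡⟨ binomial-factorial (s≤s k≤n) ⟩
    suc n * n !
      ≡⟨ cong (suc n *_) (binomial-factorial k≤n) ⟨
    suc n * ((n C k) * (k ! * (n ∸ k) !))
      ≡⟨ *-assoc (suc n) (n C k) _ ⟨
    suc n * (n C k) * (k ! * (n ∸ k) !) ∎)
  where
  open ≡-Reasoning
  regroup : ∀ s c f g → s * c * (f * g) ≡ c * (s * f * g)
  regroup = solve-∀

prime>1 : ∀ {p} → Prime p → 1 < p
prime>1 {p} pp = nonTrivial⇒n>1 p {{prime⇒nonTrivial pp}}

primePower-cancel : ∀ {p} → Prime p → ∀ a x c → p ^ a ∣ x * c → ¬ p ∣ c → p ^ a ∣ x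
primePower-cancel pp zero x c _ _ = 1∣ x
primePower-cancel {p} pp (suc a) x c pa∣xc p∤c with euclidsLemma x c pp (∣-trans (m∣m*n (p ^ a)) pa∣xc)
... | inj₂ p∣c = ⊥-elim (p∤c p∣c)
... | inj₁ (divides y refl) = subst (_∣ y * p) (*-comm (p ^ a) p) (*-monoˡ-∣ p pa∣y)
  where
  instance _ = prime⇒nonZero pp
  pa∣y : p ^ a ∣ y
  pa∣y = primePower-cancel pp a y c
           (*-cancelˡ-∣ p (subst (p * p ^ a ∣_) (regroup y p c) pa∣xc)) p∤c
    where
    regroup : ∀ y p c → y * p * c ≡ p * (y * c)
    regroup = solve-∀

-- If p ^ a ∣ n and p ∤ (n C k) for 0 < k ≤ n, then p ^ a ∣ k: by absorption
-- p ^ a divides k · (n C k), and the second factor is prime to p.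
primePower∣index : ∀ {p} → Prime p → ∀ a n k → p ^ a ∣ n → ¬ p ∣ n C k → 1 ≤ k → k ≤ n → p ^ a ∣ k
primePower∣index {p} pp a (suc n) (suc k) pa∣n p∤C _ (s≤s k≤n) =
  primePower-cancel pp a (suc k) (suc n C suc k) pa∣kC p∤C
  where
  pa∣kC : p ^ a ∣ suc k * (suc n C suc k)
  pa∣kC = subst (p ^ a ∣_) (sym (binomial-absorption k≤n)) (∣-trans pa∣n (m∣m*n (n C k)))

prime∤factorial : ∀ {q} → Prime q → ∀ j → j < q → ¬ q ∣ j !
prime∤factorial qp zero _ q∣1 = <⇒≢ (prime>1 qp) (sym (∣1⇒≡1 q∣1))
prime∤factorial qp (suc j) j<q q∣j! with euclidsLemma (suc j) (j !) qp q∣j!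
... | inj₁ q∣j+1 = <⇒≱ j<q (∣⇒≤ q∣j+1)
... | inj₂ q∣j!  = prime∤factorial qp j (<-trans (n<1+n j) j<q) q∣j!

-- Lower half of Legendre's formula in the range r ≤ q: q ^ r ∤ j ! when
-- j < r · q.  The only multiples of q up to j are c · q with c < r ≤ q, and
-- each contributes exactly one factor q.
primePower∤factorial : ∀ {q} → Prime q → ∀ r j → r ≤ q → j < r * q → ¬ q ^ r ∣ j !
primePower∤factorial qp zero j _ () _
primePower∤factorial qp (suc r) zero _ _ qr∣1 =
  <⇒≢ (prime>1 qp) (sym (∣1⇒≡1 (∣-trans (m∣m*n _) qr∣1)))
primePower∤factorial {q} qp (suc r) (suc j) r<q j<rq qr∣j! with q ∣? suc j
... | no q∤j+1 =
  primePower∤factorial qp (suc r) j r<q (<-trans (n<1+n j) j<rq)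
    (primePower-cancel qp (suc r) (j !) (suc j) (subst (q ^ suc r ∣_) (*-comm (suc j) (j !)) qr∣j!) q∤j+1)
... | yes (divides c j+1≡cq) =
  primePower∤factorial qp r j (<⇒≤ r<q) j<rq′
    (primePower-cancel qp r (j !) c (subst (q ^ r ∣_) (*-comm c (j !)) qr∣cj!) q∤c)
  where
  instance _ = prime⇒nonZero qp
  c≤r : c ≤ r
  c≤r = ≤-pred (*-cancelʳ-< q c (suc r) (subst (_< suc r * q) j+1≡cq j<rq))
  c≢0 : NonZero c
  c≢0 = m*n≢0⇒m≢0 c {{subst NonZero j+1≡cq _}}
  q∤c : ¬ q ∣ c
  q∤c q∣c = <⇒≱ (≤-<-trans c≤r r<q) (∣⇒≤ {{c≢0}} q∣c)
  qr∣cj! : q ^ r ∣ c * j !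
  qr∣cj! = *-cancelˡ-∣ q (subst (q * q ^ r ∣_) (trans (cong (_* j !) j+1≡cq) (regroup c q (j !))) qr∣j!)
    where
    regroup : ∀ c q f → c * q * f ≡ q * (c * f)
    regroup = solve-∀
  j<rq′ : j < r * q
  j<rq′ = subst (_≤ r * q) (sym j+1≡cq) (*-monoˡ-≤ q c≤r)

-- Upper half of Legendre's formula: q ^ r ∣ (r · q) !, since
-- (r · q + q) ! = (r + 1) · q · (r · q + q - 1) ! and (r · q) ! ∣ (r · q + q - 1) !.
primePower∣factorial : ∀ {q} → 0 < q → ∀ r → q ^ r ∣ (r * q) !
primePower∣factorial _ zero = 1∣ 1
primePower∣factorial {suc q′} q>0 (suc r) =
  *-pres-∣ (n∣m*n (suc r) {suc q′})
           (∣-trans (primePower∣factorial q>0 r) (m≤n⇒m!∣n! (m≤n+m (r * suc q′) q′)))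

multiples-gap : ∀ {d x y} → d ∣ x → d ∣ y → x < y → x + d ≤ y
multiples-gap {d} {x} {y} d∣x d∣y x<y = begin
    x + d        ≤⟨ +-monoʳ-≤ x (∣⇒≤ {{>-nonZero (m<n⇒0<n∸m x<y)}} d∣y∸x) ⟩
    x + (y ∸ x)  ≡⟨ x+[y∸x]≡y ⟩
    y            ∎
  where
  open ≤-Reasoning
  x+[y∸x]≡y : x + (y ∸ x) ≡ y
  x+[y∸x]≡y = m+[n∸m]≡n (<⇒≤ x<y)
  d∣y∸x : d ∣ y ∸ x
  d∣y∸x = ∣m+n∣m⇒∣n (subst (d ∣_) (sym x+[y∸x]≡y) d∣y) d∣x

-- Otherwise q divides
-- neither n C k nor (n - k) !, so q ^ 2 ∣ n ! = (n C k) · k ! · (n - k) !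
-- would force q ^ 2 ∣ k !, which fails as k < 2q.
largeComplement : ∀ {q n k} → Prime q → 2 * q ≤ n → k ≤ n → k < 2 * q → ¬ q ∣ n C k → q ≤ n ∸ k
largeComplement {q} {n} {k} qp 2q≤n k≤n k<2q q∤C with n ∸ k <? q
... | no  n∸k≮q = ≮⇒≥ n∸k≮q
... | yes n∸k<q = ⊥-elim (primePower∤factorial qp 2 k (prime>1 qp) k<2q q²∣k!)
  where
  q²∣n! : q ^ 2 ∣ n !
  q²∣n! = ∣-trans (primePower∣factorial (<-trans z<s (prime>1 qp)) 2) (m≤n⇒m!∣n! 2q≤n)
  q∤C[n∸k]! : ¬ q ∣ (n C k) * (n ∸ k) !
  q∤C[n∸k]! q∣ with euclidsLemma (n C k) ((n ∸ k) !) qp q∣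
  ... | inj₁ q∣C       = q∤C q∣C
  ... | inj₂ q∣[n∸k]! = prime∤factorial qp (n ∸ k) n∸k<q q∣[n∸k]!
  regroup : ∀ c f g → c * (f * g) ≡ f * (c * g)
  regroup = solve-∀
  q²∣k! : q ^ 2 ∣ k !
  q²∣k! = primePower-cancel qp 2 (k !) ((n C k) * (n ∸ k) !)
            (subst (q ^ 2 ∣_) (trans (sym (binomial-factorial k≤n)) (regroup (n C k) (k !) ((n ∸ k) !))) q²∣n!)
            q∤C[n∸k]!

onlyCentral : ∀ {p q a n} → Prime p → Prime q → p ^ a ∣ n → 2 * q ≤ n → n < 2 * q + p ^ a
              → ∀ k → 1 ≤ k → k < n → ¬ p ∣ n C k → ¬ q ∣ n C k → k + k ≡ n
onlyCentral {p} {q} {a} {n} pp qp pa∣n 2q≤n n<2q+P k 1≤k k<n p∤C q∤C =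
  trans (cong (k +_) k≡l) k+l≡n
  where
  P = p ^ a
  l = n ∸ k
  k+l≡n : k + l ≡ n
  k+l≡n = m+[n∸m]≡n (<⇒≤ k<n)
  l+k≡n : l + k ≡ n
  l+k≡n = trans (+-comm l k) k+l≡n
  1≤l : 1 ≤ l
  1≤l = m<n⇒0<n∸m k<n
  C-symmetry : n C l ≡ n C k
  C-symmetry = sym (nCk≡nC[n∸k] (<⇒≤ k<n))
  P∣k : P ∣ k
  P∣k = primePower∣index pp a n k pa∣n p∤C 1≤k (<⇒≤ k<n)
  P∣l : P ∣ l
  P∣l = primePower∣index pp a n l pa∣n (λ p∣C → p∤C (subst (p ∣_) C-symmetry p∣C)) 1≤l (m∸n≤m n k)
  -- Each part is below 2q, since the other part is a positive multiple of P.
  below : ∀ x y → x + y ≡ n → 1 ≤ y → P ∣ y → x < 2 * q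
  below x y x+y≡n 1≤y P∣y = +-cancelʳ-< y x (2 * q) (begin-strict
    x + y      ≡⟨ x+y≡n ⟩
    n          <⟨ n<2q+P ⟩
    2 * q + P  ≤⟨ +-monoʳ-≤ (2 * q) (∣⇒≤ {{>-nonZero 1≤y}} P∣y) ⟩
    2 * q + y  ∎)
    where open ≤-Reasoning
  q≤l : q ≤ l
  q≤l = largeComplement qp 2q≤n (<⇒≤ k<n) (below k l k+l≡n 1≤l P∣l) q∤C
  q≤k : q ≤ k
  q≤k = subst (q ≤_) (m∸[m∸n]≡n (<⇒≤ k<n))
          (largeComplement qp 2q≤n (m∸n≤m n k) (below l k l+k≡n 1≤k P∣k)
            (λ q∣C → q∤C (subst (q ∣_) C-symmetry q∣C)))
  -- Distinct parts would be separated by P, pushing their sum to 2q + P.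
  separated : ∀ x y → q ≤ x → x < y → P ∣ x → P ∣ y → x + y ≡ n → k ≡ l
  separated x y q≤x x<y P∣x P∣y x+y≡n = ⊥-elim (<⇒≱ n<2q+P (begin
    2 * q + P      ≡⟨ regroup q P ⟩
    q + (q + P)    ≤⟨ +-mono-≤ q≤x (+-monoˡ-≤ P q≤x) ⟩
    x + (x + P)    ≤⟨ +-monoʳ-≤ x (multiples-gap P∣x P∣y x<y) ⟩
    x + y          ≡⟨ x+y≡n ⟩
    n              ∎))
    where
    open ≤-Reasoning
    regroup : ∀ q P → 2 * q + P ≡ q + (q + P)
    regroup = solve-∀
  k≡l : k ≡ l
  k≡l with <-cmp k l
  ... | tri< k<l _ _ = separated k l q≤k k<l P∣k P∣l k+l≡n
  ... | tri≈ _ k≡l _ = k≡l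
  ... | tri> _ _ l<k = separated l k q≤l l<k P∣l P∣k l+k≡n

-- If q ≤ m, 2m < 3q and q ≥ 3, then q ∤ (2m C m): the prime q divides
-- m ! · m ! at least twice, while q ^ 3 ∤ (2m) !.
central-prime-to-q : ∀ {q} m → Prime q → 3 ≤ q → q ≤ m → 2 * m < 3 * q → ¬ q ∣ (2 * m) C m
central-prime-to-q {q} m qp 3≤q q≤m 2m<3q q∣C =
  primePower∤factorial qp 3 (2 * m) 3≤q 2m<3q q³∣[2m]!
  where
  q¹∣m! : q ^ 1 ∣ m !
  q¹∣m! = ∣-trans (primePower∣factorial (<-trans z<s (prime>1 qp)) 1)
                  (m≤n⇒m!∣n! (subst (_≤ m) (sym (+-identityʳ q)) q≤m))
  m≤2m : m ≤ 2 * m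
  m≤2m = m≤m+n m (m + 0)
  2m∸m≡m : 2 * m ∸ m ≡ m
  2m∸m≡m = trans (m+n∸m≡n m (m + 0)) (+-identityʳ m)
  q²∣m!m! : q ^ 2 ∣ m ! * (2 * m ∸ m) !
  q²∣m!m! = subst (λ z → q ^ 2 ∣ m ! * z !) (sym 2m∸m≡m) (*-pres-∣ (m*n∣⇒m∣ q 1 q¹∣m!) q¹∣m!)
  q³∣[2m]! : q ^ 3 ∣ (2 * m) !
  q³∣[2m]! = subst (q ^ 3 ∣_) (binomial-factorial m≤2m) (*-pres-∣ q∣C q²∣m!m!)

three≤q : ∀ {q m} → 2 * q < 2 * m → 2 * m < 3 * q → 3 ≤ q
three≤q {q} {m} 2q<2m 2m<3q = +-cancelˡ-< (2 * q) 2 q (begin-strict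
    2 * q + 2  ≡⟨ regroup q ⟩
    2 * suc q  ≤⟨ *-monoʳ-≤ 2 (*-cancelˡ-< 2 q m 2q<2m) ⟩
    2 * m      <⟨ 2m<3q ⟩
    3 * q      ≡⟨ split q ⟩
    2 * q + q  ∎)
  where
  open ≤-Reasoning
  regroup : ∀ q → 2 * q + 2 ≡ 2 * suc q
  regroup = solve-∀
  split : ∀ q → 3 * q ≡ 2 * q + q
  split = solve-∀

condition1-byContradiction : ∀ {n p q}
  → (∀ k → 1 ≤ k → k + 1 ≤ n → ¬ p ∣ n C k → ¬ q ∣ n C k → ⊥) → Condition1 n p q
condition1-byContradiction {n} {p} {q} no-exception k 1≤k k+1≤n with p ∣? n C k | q ∣? n C k
... | yes p∣C | _       = inj₁ p∣C
... | no _    | yes q∣C = inj₂ q∣C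
... | no p∤C  | no q∤C  = ⊥-elim (no-exception k 1≤k k+1≤n p∤C q∤C)

theorem3p5 : ∀ (m p a q : ℕ) → 1 ≤ m → Prime p → p ^ a ∣ 2 * m → ¬ (p ^ suc a ∣ 2 * m)
             → Prime q → 2 * m < 3 * q → 2 * q < 2 * m → 2 * m ∸ 2 * q < p ^ a
             → (p ≡ 2 → Condition1 (2 * m) 2 q)
               × (p ≢ 2 → (Condition1 (2 * m) p q ⇔ (p ∣ (2 * m) C m)))
theorem3p5 m p a q 1≤m pp pa∣n pa+1∤n qp n<3q 2q<n n∸2q<pa = part-a , λ _ → mk⇔ only-if if
  -- The equivalence in (b) holds for p = 2 as well.
  where
  n = 2 * m
  window : n < 2 * q + p ^ a
  window = ≤-<-trans (m≤n+m∸n n (2 * q)) (+-monoʳ-< (2 * q) n∸2q<pa)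
  exception-is-central : ∀ k → 1 ≤ k → k + 1 ≤ n → ¬ p ∣ n C k → ¬ q ∣ n C k → k ≡ m
  exception-is-central k 1≤k k+1≤n p∤C q∤C = *-cancelˡ-≡ k m 2 (trans (cong (k +_) (+-identityʳ k))
    (onlyCentral {a = a} pp qp pa∣n (<⇒≤ 2q<n) window k 1≤k (subst (_≤ n) (+-comm k 1) k+1≤n) p∤C q∤C))
  -- (a): for p = 2 the central exception would give 2 ^ (a + 1) ∣ 2m.
  part-a : p ≡ 2 → Condition1 n 2 q
  part-a refl = condition1-byContradiction λ k 1≤k k+1≤n 2∤C q∤C →
    pa+1∤n (subst (λ z → 2 * 2 ^ a ∣ 2 * z) (exception-is-central k 1≤k k+1≤n 2∤C q∤C)
             (*-monoʳ-∣ 2 (primePower∣index pp a n k pa∣n 2∤C 1≤k (≤-trans (m≤m+n k 1) k+1≤n))))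
  -- (b): k = m is the only possible exception, and q never divides n C m.
  if : p ∣ n C m → Condition1 n p q
  if p∣C = condition1-byContradiction λ k 1≤k k+1≤n p∤C q∤C →
    p∤C (subst (λ z → p ∣ n C z) (sym (exception-is-central k 1≤k k+1≤n p∤C q∤C)) p∣C)
  only-if : Condition1 n p q → p ∣ n C m
  only-if condition with condition m 1≤m (+-monoʳ-≤ m (subst (1 ≤_) (sym (+-identityʳ m)) 1≤m))
  ... | inj₁ p∣C = p∣C
  ... | inj₂ q∣C = ⊥-elim (central-prime-to-q m qp (three≤q {q} {m} 2q<n n<3q) (<⇒≤ (*-cancelˡ-< 2 q m 2q<n)) n<3q q∣C)
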